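{- Let $s\geq t\geq 1$ be integers. If an $r$-regular graph $G$ has $K_{t,s}$ as a star complement for the eigenvalue $\mu=r$, then either $s=t=1$ and $G\cong C_3$, or $r=s=t+1$ and $G\cong K_{t+1,t+1}$.
   Context: All graphs are finite and simple; eigenvalues are eigenvalues of the adjacency matrix. If $\mu$ is an eigenvalue of a graph $G$ with multiplicity $k\geq 1$, a star set for $\mu$ in $G$ is a vertex subset $X\subseteq V(G)$ with $|X|=k$ such that $\mu$ is not an eigenvalue of the induced subgraph $G-X$; $H=G-X$ is then a star complement for $\mu$. "$G$ has $K_{t,s}$ as a star complement for $\mu$" means some star set $X$ for $\mu$ satisfies $G-X\cong K_{t,s}$. $C_3$ denotes the triangle. -}

module Defs where

open import Data.Nat as ℕ using (ℕ; zero; suc; _<_; _≤_; _∸_)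
import Data.Nat.Properties as ℕP
open import Data.Integer using (+_)
open import Data.Rational using (ℚ; 0ℚ; 1ℚ; _+_; _*_; _/_)
open import Data.Bool using (Bool; true; false; if_then_else_; _xor_)
open import Data.Fin using (Fin; zero; suc; toℕ)
open import Data.Fin.Subset using (Subset; _∈_; _∉_; ∣_∣)
open import Data.Product using (Σ; ∃; _×_; _,_)
open import Function using (_↔_; Injective)
import Function
import Data.Bool
import Data.Fin
open import Relation.Binary.PropositionalEquality using (_≡_; _≢_)
open import Relation.Nullary using (¬_; Dec; does)
open import Data.Nat using (_<?_)

record Graph (n : ℕ) : Set where
  field
    adj   : Fin n → Fin n → Bool
    sym   : ∀ i j → adj i j ≡ adj j i
    irref : ∀ i → adj i i ≡ false
open Graph public

Σℚ : (n : ℕ) → (Fin n → ℚ) → ℚ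
Σℚ zero    f = 0ℚ
Σℚ (suc n) f = f zero + Σℚ n (λ i → f (suc i))

Σℕ : (n : ℕ) → (Fin n → ℕ) → ℕ
Σℕ zero    f = 0
Σℕ (suc n) f = f zero ℕ.+ Σℕ n (λ i → f (suc i))

degree : ∀ {n} → Graph n → Fin n → ℕ
degree {n} G v = Σℕ n (λ w → if adj G v w then 1 else 0)

Regular : ∀ {n} → Graph n → ℕ → Set
Regular {n} G r = ∀ v → degree G v ≡ r

A : ∀ {n} → Graph n → Fin n → Fin n → ℚ
A G i j = if adj G i j then 1ℚ else 0ℚ

ℕtoℚ : ℕ → ℚ
ℕtoℚ r = + r / 1

InEigenspace : ∀ {n} → Graph n → ℚ → (Fin n → ℚ) → Set
InEigenspace {n} G μ x = ∀ i → Σℚ n (λ j → A G i j * x j) ≡ μ * x i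

IsEigenvalue : ∀ {n} → ℚ → Graph n → Set
IsEigenvalue {n} μ G = Σ (Fin n → ℚ) λ x → InEigenspace G μ x × Σ (Fin n) λ i → x i ≢ 0ℚ

LinIndep : ∀ {k n} → (Fin k → Fin n → ℚ) → Set
LinIndep {k} {n} vs =
  (c : Fin k → ℚ) → (∀ j → Σℚ k (λ i → c i * vs i j) ≡ 0ℚ) → ∀ i → c i ≡ 0ℚ

Multiplicity : ∀ {n} → ℚ → Graph n → ℕ → Set
Multiplicity {n} μ G k =
  (Σ (Fin k → Fin n → ℚ) λ vs → (∀ i → InEigenspace G μ (vs i)) × LinIndep vs)
  × ((vs : Fin (suc k) → Fin n → ℚ) → (∀ i → InEigenspace G μ (vs i)) → ¬ LinIndep vs)

induced : ∀ {m n} → Graph n → (Fin m → Fin n) → Graph m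
induced G e = record
  { adj = λ i j → adj G (e i) (e j)
  ; sym = λ i j → sym G (e i) (e j)
  ; irref = λ i → irref G (e i) }

_≅_ : ∀ {m n} → Graph m → Graph n → Set
_≅_ {m} {n} G H =
  Σ (Fin m ↔ Fin n) λ f → ∀ i j → adj H (Function.Inverse.to f i) (Function.Inverse.to f j) ≡ adj G i j

-- X is a star set for μ in G, and G - X (realised as the subgraph induced on an
-- injective enumeration e of the complement of X) is isomorphic to H
record HasStarComplement {n m} (G : Graph n) (μ : ℚ) (H : Graph m) : Set where
  field
    X        : Subset n
    k        : ℕ
    mult     : Multiplicity μ G k
    k≥1      : 1 ≤ k
    size     : ∣ X ∣ ≡ k
    e        : Fin m → Fin n
    e-inj    : Injective _≡_ _≡_ e
    e-image  : ∀ v → (v ∉ X → ∃ λ i → e i ≡ v) × ((∃ λ i → e i ≡ v) → v ∉ X)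
    notEig   : ¬ IsEigenvalue μ (induced G e)
    iso      : induced G e ≅ H

-- complete bipartite graph K_{t,s}: parts {0..t-1} and {t..t+s-1}
K : (t s : ℕ) → Graph (t ℕ.+ s)
K t s = record
  { adj = λ i j → does (toℕ i <? t) xor does (toℕ j <? t)
  ; sym = λ i j → xor-comm (does (toℕ i <? t)) (does (toℕ j <? t))
  ; irref = λ i → xor-self (does (toℕ i <? t)) }
  where
    xor-comm : ∀ a b → (a xor b) ≡ (b xor a)
    xor-comm true true = _≡_.refl
    xor-comm true false = _≡_.refl
    xor-comm false true = _≡_.refl
    xor-comm false false = _≡_.refl
    xor-self : ∀ a → (a xor a) ≡ false
    xor-self true = _≡_.refl
    xor-self false = _≡_.refl

C3 : Graph 3
C3 = record
  { adj = λ i j → Data.Bool.not (does (i Data.Fin.≟ j))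
  ; sym = λ i j → sym' i j
  ; irref = λ i → irr i }
  where
    open import Relation.Nullary.Decidable using (dec-true; dec-false)
    open import Data.Fin.Properties using () renaming (_≟_ to _≟F_)
    sym' : ∀ (i j : Fin 3) → Data.Bool.not (does (i Data.Fin.≟ j)) ≡ Data.Bool.not (does (j Data.Fin.≟ i))
    sym' zero zero = _≡_.refl
    sym' zero (suc zero) = _≡_.refl
    sym' zero (suc (suc zero)) = _≡_.refl
    sym' (suc zero) zero = _≡_.refl
    sym' (suc zero) (suc zero) = _≡_.refl
    sym' (suc zero) (suc (suc zero)) = _≡_.refl
    sym' (suc (suc zero)) zero = _≡_.refl
    sym' (suc (suc zero)) (suc zero) = _≡_.refl
    sym' (suc (suc zero)) (suc (suc zero)) = _≡_.refl
    irr : ∀ (i : Fin 3) → Data.Bool.not (does (i Data.Fin.≟ i)) ≡ false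
    irr zero = _≡_.refl
    irr (suc zero) = _≡_.refl
    irr (suc (suc zero)) = _≡_.refl

-- An eigenvector x for the eigenvalue r of an r-regular graph is constant along every edge, because
-- the sum of (x v − x w)² over ordered pairs of adjacent vertices equals 2 xᵀ(r I − A) x = 0.
-- It is therefore constant on the connected star complement K t s.  Two distinct vertices p, q of a
-- star set X cannot carry equal values in every eigenvector: otherwise a nontrivial combination of
-- the k independent eigenvectors vanishes on the k − 1 vertices X ∖ q, hence on X, and its
-- restriction to G − X is an eigenvector of G − X unless it is zero.  Every vertex of X has a
-- neighbour (r ≥ 1), which by the above cannot lie in X and so lies in K t s; hence all vertices of
-- X take the common value of K t s in every eigenvector, and X is a single vertex x.  Then r = [a ~ x] + deg a for every vertex a of
-- K t s, so adjacency to x only depends on the side of a, and the four possibilities give C₃, a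
-- contradiction with t ≤ s, the graph K (t+1) (t+1), or a contradiction with the degree of x.
module Submission where

open import Algebra.Bundles using (CommutativeMonoid; CommutativeRing; Semiring)
import Algebra.Properties.CommutativeMonoid.Sum as MonoidSum
import Algebra.Properties.Group as GroupProperties
import Algebra.Properties.Semiring.Sum as SemiringSum
open import Data.Bool using (Bool; true; false; if_then_else_; not; _xor_)
open import Data.Empty using (⊥; ⊥-elim)
open import Data.Fin as Fin using (Fin; zero; suc; toℕ; punchIn; punchOut; _↑ʳ_)
import Data.Fin.Permutation as Perm
open import Data.Fin.Properties
  using ( toℕ-fromℕ<; all?; ¬∀⟶∃¬; suc-injective
        ; punchInᵢ≢i; punchIn-punchOut; punchOut-punchIn; punchOut-injective; punchOut-cong)
open import Data.Fin.Subset using (Subset; Nonempty; _∈_; ∣_∣; inside; outside) renaming (_-_ to _∖_)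
open import Data.Fin.Subset.Properties
  using (_∈?_; nonempty?; Empty-unique; ∣⊥∣≡0; x∈p⇒∣p-x∣<∣p∣; x∈p∧x≢y⇒x∈p-y)
import Data.Integer as ℤ
import Data.Integer.Properties as ℤP
open import Data.Nat as ℕ using (ℕ; zero; suc; _≤_; _<_; _<?_; s≤s; z≤n)
import Data.Nat.Coprimality as Coprime
import Data.Nat.Properties as ℕP
open import Data.Product using (∃; _×_; _,_; proj₁; proj₂; map₂)
open import Data.Rational as ℚ using (ℚ; 0ℚ; 1ℚ; _+_; _*_; _-_; -_; 1/_)
import Data.Rational.Properties as ℚP
open import Data.Rational.Solver using (module +-*-Solver)
open import Data.Sum as Sum using (_⊎_; inj₁; inj₂)
open import Data.Vec using ([]; _∷_; there)
open import Data.Vec.Functional using (insertAt)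
open import Data.Vec.Functional.Properties using (insertAt-lookup; insertAt-punchIn)
open import Function using (_∘_; Injective; _↔_; Inverse; mk↔ₛ′)
open import Function.Construct.Composition using (_↔-∘_)
open import Function.Construct.Identity using (↔-id)
open import Function.Construct.Symmetry using (↔-sym)
open import Relation.Binary.Definitions using (tri<; tri≈; tri>)
open import Relation.Binary.PropositionalEquality as ≡
  using (_≡_; _≢_; refl; sym; trans; cong; cong₂; subst)
open import Relation.Nullary using (¬_; yes; no; does)
open import Relation.Nullary.Decidable using (decidable-stable)
open import Defs hiding (sym)

module SumProperties {a ℓ} (M : CommutativeMonoid a ℓ) where
  open CommutativeMonoid M using (setoid; _≈_; _∙_; ∙-congˡ) renaming (Carrier to C; ε to 0#)
  open MonoidSum M
  open import Relation.Binary.Reasoning.Setoid setoid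

  sum-zero : ∀ {n} (g : Fin n → C) → (∀ v → g v ≈ 0#) → sum g ≈ 0#
  sum-zero {n} g g≈0 = begin
    sum g               ≈⟨ sum-cong-≋ {n} g≈0 ⟩
    sum {n} (λ _ → 0#)  ≈⟨ sum-replicate-zero n ⟩
    0#                  ∎

  sum-image : ∀ {m n} (e : Fin m → Fin n) → Injective _≡_ _≡_ e → (g : Fin n → C) →
              (∀ v → (∀ i → e i ≢ v) → g v ≈ 0#) → sum g ≈ sum (g ∘ e)
  sum-image {zero} e _ g off-image = sum-zero g (λ v → off-image v (λ ()))
  sum-image {suc m} {zero} e _ _ _ with e zero
  ... | ()
  sum-image {suc m} {suc n} e e-inj g off-image = begin
    sum g                             ≈⟨ sum-remove {i = e₀} g ⟩
    g e₀ ∙ sum (g ∘ punchIn e₀)       ≈⟨ ∙-congˡ (sum-image e′ e′-inj (g ∘ punchIn e₀) off-image′) ⟩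
    g e₀ ∙ sum (g ∘ punchIn e₀ ∘ e′)  ≡⟨ cong (g e₀ ∙_) (sum-cong-≗ (cong g ∘ punchIn-punchOut ∘ e₀≢)) ⟩
    sum (g ∘ e)                       ∎
    where
    e₀ = e zero
    e₀≢ : ∀ i → e₀ ≢ e (suc i)
    e₀≢ i eq with e-inj eq
    ... | ()
    e′ : Fin m → Fin n
    e′ i = punchOut (e₀≢ i)
    e′-inj : Injective _≡_ _≡_ e′
    e′-inj eq = suc-injective (e-inj (punchOut-injective (e₀≢ _) (e₀≢ _) eq))
    off-image′ : ∀ w → (∀ i → e′ i ≢ w) → g (punchIn e₀ w) ≈ 0#
    off-image′ w w∉ = off-image _ λ where
      zero    eq → punchInᵢ≢i e₀ w (sym eq)
      (suc i) eq → w∉ i (trans (punchOut-cong e₀ eq) (punchOut-punchIn e₀))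

module ℕΣ = SemiringSum ℕP.+-*-semiring
module ℚΣ = SemiringSum (CommutativeRing.semiring ℚP.+-*-commutativeRing)
module ℚGroup = GroupProperties ℚP.+-0-group
open ℚΣ using (sum)
open SumProperties (Semiring.+-commutativeMonoid (CommutativeRing.semiring ℚP.+-*-commutativeRing))

Σℕ≡sum : ∀ n (f : Fin n → ℕ) → Σℕ n f ≡ ℕΣ.sum f
Σℕ≡sum zero    f = refl
Σℕ≡sum (suc n) f = cong (f zero ℕ.+_) (Σℕ≡sum n (f ∘ suc))

Σℚ≡sum : ∀ n (f : Fin n → ℚ) → Σℚ n f ≡ sum f
Σℚ≡sum zero    f = refl
Σℚ≡sum (suc n) f = cong (f zero +_) (Σℚ≡sum n (f ∘ suc))

sum₂ : ∀ {n} → (Fin n → Fin n → ℚ) → ℚ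
sum₂ f = sum λ v → sum (f v)

sum₂-cong : ∀ {n} {f g : Fin n → Fin n → ℚ} → (∀ v w → f v w ≡ g v w) → sum₂ f ≡ sum₂ g
sum₂-cong eq = ℚΣ.sum-cong-≗ (λ v → ℚΣ.sum-cong-≗ (eq v))

sum₂-distrib : ∀ {n} (f g : Fin n → Fin n → ℚ) → sum₂ (λ v w → f v w + g v w) ≡ sum₂ f + sum₂ g
sum₂-distrib f g =
  trans (ℚΣ.sum-cong-≗ (λ v → ℚΣ.∑-distrib-+ (f v) (g v))) (ℚΣ.∑-distrib-+ (λ v → sum (f v)) (λ v → sum (g v)))

ind : Bool → ℕ
ind b = if b then 1 else 0

ind-injective : ∀ {a b} → ind a ≡ ind b → a ≡ b
ind-injective {true}  {true}  _ = refl
ind-injective {false} {false} _ = refl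

count : ∀ {n} → (Fin n → Bool) → ℕ
count {n} b = Σℕ n (ind ∘ b)

count-cong : ∀ {n} {b c : Fin n → Bool} → (∀ i → b i ≡ c i) → count b ≡ count c
count-cong {zero}  eq = refl
count-cong {suc n} eq = cong₂ ℕ._+_ (cong ind (eq zero)) (count-cong (eq ∘ suc))

count-false : ∀ {n} (b : Fin n → Bool) → (∀ i → b i ≡ false) → count b ≡ 0
count-false {zero}  b eq = refl
count-false {suc n} b eq = cong₂ ℕ._+_ (cong ind (eq zero)) (count-false (b ∘ suc) (eq ∘ suc))

count-true : ∀ {n} (b : Fin n → Bool) → (∀ i → b i ≡ true) → count b ≡ n
count-true {zero}  b eq = refl
count-true {suc n} b eq = cong₂ ℕ._+_ (cong ind (eq zero)) (count-true (b ∘ suc) (eq ∘ suc))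

count-pos⇒witness : ∀ {n} (b : Fin n → Bool) → 1 ≤ count b → ∃ λ i → b i ≡ true
count-pos⇒witness {suc n} b pos with b zero in b₀
... | true  = zero , b₀
... | false with count-pos⇒witness (b ∘ suc) pos
...   | i , bᵢ = suc i , bᵢ

witness⇒count-pos : ∀ {n} (b : Fin n → Bool) {i} → b i ≡ true → 1 ≤ count b
witness⇒count-pos b {zero}  bᵢ rewrite bᵢ = s≤s z≤n
witness⇒count-pos b {suc i} bᵢ = ℕP.≤-trans (witness⇒count-pos (b ∘ suc) bᵢ) (ℕP.m≤n+m _ (ind (b zero)))

count-reindex : ∀ {m n} (π : Fin m ↔ Fin n) (b : Fin n → Bool) → count b ≡ count (b ∘ Inverse.to π)
count-reindex {m} {n} π b = begin
  count b                          ≡⟨ Σℕ≡sum n (ind ∘ b) ⟩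
  ℕΣ.sum (ind ∘ b)                 ≡⟨ ℕΣ.sum-permute (ind ∘ b) π ⟩
  ℕΣ.sum (ind ∘ b ∘ Inverse.to π)  ≡⟨ Σℕ≡sum m (ind ∘ b ∘ Inverse.to π) ⟨
  count (b ∘ Inverse.to π)         ∎
  where open ≡.≡-Reasoning

ℕtoℚ-suc : ∀ k → ℕtoℚ (suc k) ≡ 1ℚ + ℕtoℚ k
ℕtoℚ-suc k rewrite ℚP.normalize-coprime (Coprime.sym (Coprime.1-coprimeTo k)) =
  cong (λ z → (ℤ.+ 1 ℤ.+ z) ℚ./ 1) (sym (ℤP.*-identityʳ (ℤ.+ k)))

sum-indicator : ∀ {n} (b : Fin n → Bool) → sum (λ i → if b i then 1ℚ else 0ℚ) ≡ ℕtoℚ (count b)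
sum-indicator {zero}  b = refl
sum-indicator {suc n} b with b zero
... | true  = trans (cong (1ℚ +_) (sum-indicator (b ∘ suc))) (sym (ℕtoℚ-suc (count (b ∘ suc))))
... | false = trans (ℚP.+-identityˡ _) (sum-indicator (b ∘ suc))

square-pos : ∀ x → x ≢ 0ℚ → 0ℚ ℚ.< x * x
square-pos x x≢0 with ℚP.<-cmp x 0ℚ
... | tri< x<0 _ _ = ℚP.positive⁻¹ _ {{ℚP.neg*neg⇒pos x {{ℚ.negative x<0}} x {{ℚ.negative x<0}}}}
... | tri≈ _ x≡0 _ = ⊥-elim (x≢0 x≡0)
... | tri> _ _ x>0 = ℚP.positive⁻¹ _ {{ℚP.pos*pos⇒pos x {{ℚ.positive x>0}} x {{ℚ.positive x>0}}}}

square-nonneg : ∀ x → 0ℚ ℚ.≤ x * x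
square-nonneg x with x ℚ.≟ 0ℚ
... | yes refl = ℚP.≤-refl
... | no  x≢0  = ℚP.<⇒≤ (square-pos x x≢0)

square≡0⇒≡0 : ∀ x → x * x ≡ 0ℚ → x ≡ 0ℚ
square≡0⇒≡0 x x²≡0 = decidable-stable (x ℚ.≟ 0ℚ) (λ x≢0 → ℚP.<-irrefl (sym x²≡0) (square-pos x x≢0))

nonneg+nonneg≡0⇒≡0 : ∀ {a b} → 0ℚ ℚ.≤ a → 0ℚ ℚ.≤ b → a + b ≡ 0ℚ → a ≡ 0ℚ
nonneg+nonneg≡0⇒≡0 {a} {b} a≥0 b≥0 a+b≡0 = ℚP.≤-antisym a≤0 a≥0
  where
  open ℚP.≤-Reasoning
  a≤0 : a ℚ.≤ 0ℚ
  a≤0 = begin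
    a       ≡⟨ ℚP.+-identityʳ a ⟨
    a + 0ℚ  ≤⟨ ℚP.+-monoʳ-≤ a b≥0 ⟩
    a + b   ≡⟨ a+b≡0 ⟩
    0ℚ      ∎

sum-nonneg : ∀ {n} (f : Fin n → ℚ) → (∀ i → 0ℚ ℚ.≤ f i) → 0ℚ ℚ.≤ sum f
sum-nonneg {zero}  f f≥0 = ℚP.≤-refl
sum-nonneg {suc n} f f≥0 = ℚP.+-mono-≤ (f≥0 zero) (sum-nonneg (f ∘ suc) (f≥0 ∘ suc))

sum-nonneg≡0⇒≡0 : ∀ {n} (f : Fin n → ℚ) → (∀ i → 0ℚ ℚ.≤ f i) → sum f ≡ 0ℚ → ∀ i → f i ≡ 0ℚ
sum-nonneg≡0⇒≡0 f f≥0 eq zero = nonneg+nonneg≡0⇒≡0 (f≥0 zero) (sum-nonneg (f ∘ suc) (f≥0 ∘ suc)) eq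
sum-nonneg≡0⇒≡0 f f≥0 eq (suc i) = sum-nonneg≡0⇒≡0 (f ∘ suc) (f≥0 ∘ suc)
  (nonneg+nonneg≡0⇒≡0 (sum-nonneg (f ∘ suc) (f≥0 ∘ suc)) (f≥0 zero) (trans (ℚP.+-comm _ (f zero)) eq)) i

A-sym : ∀ {n} (G : Graph n) v w → A G v w ≡ A G w v
A-sym G v w = cong (λ b → if b then 1ℚ else 0ℚ) (Graph.sym G v w)

sum-A : ∀ {n} (G : Graph n) v → sum (A G v) ≡ ℕtoℚ (degree G v)
sum-A G v = sum-indicator (adj G v)

adjacent⇒≢ : ∀ {n} (G : Graph n) {v w} → adj G v w ≡ true → v ≢ w
adjacent⇒≢ G {v} v~w refl with trans (sym (irref G v)) v~w
... | ()

≅-sym : ∀ {m n} {G : Graph m} {H : Graph n} → G ≅ H → H ≅ G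
≅-sym {H = H} (f , f-adj) = ↔-sym f , λ i j →
  trans (sym (f-adj (Inverse.from f i) (Inverse.from f j)))
        (cong₂ (adj H) (Inverse.strictlyInverseˡ f i) (Inverse.strictlyInverseˡ f j))

≅-trans : ∀ {l m n} {G : Graph l} {H : Graph m} {I : Graph n} → G ≅ H → H ≅ I → G ≅ I
≅-trans (f , f-adj) (g , g-adj) = g ↔-∘ f , λ i j → trans (g-adj _ _) (f-adj i j)

degree-≅ : ∀ {m n} {G : Graph m} {H : Graph n} ((f , _) : G ≅ H) → ∀ i → degree H (Inverse.to f i) ≡ degree G i
degree-≅ {H = H} (f , f-adj) i = trans (count-reindex f (adj H (Inverse.to f i))) (count-cong (f-adj i))

regular-≅ : ∀ {m n r} {G : Graph m} {H : Graph n} → G ≅ H → Regular H r → Regular G r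
regular-≅ {G = G} {H} iso regular i = trans (sym (degree-≅ {G = G} {H} iso i)) (regular _)

addVertex : ∀ {m} → Graph m → (Fin m → Bool) → Graph (suc m)
addVertex {m} H α = record { adj = adj⁺ ; sym = sym⁺ ; irref = irref⁺ }
  where
  adj⁺ : Fin (suc m) → Fin (suc m) → Bool
  adj⁺ zero    zero    = false
  adj⁺ zero    (suc j) = α j
  adj⁺ (suc i) zero    = α i
  adj⁺ (suc i) (suc j) = adj H i j
  sym⁺ : ∀ i j → adj⁺ i j ≡ adj⁺ j i
  sym⁺ zero    zero    = refl
  sym⁺ zero    (suc j) = refl
  sym⁺ (suc i) zero    = refl
  sym⁺ (suc i) (suc j) = Graph.sym H i j
  irref⁺ : ∀ i → adj⁺ i i ≡ false
  irref⁺ zero    = refl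
  irref⁺ (suc i) = irref H i

part : ∀ {n} → ℕ → Fin n → Bool
part t i = does (toℕ i <? t)

part-↑ʳ : ∀ t {s} (j : Fin s) → part t (t ↑ʳ j) ≡ false
part-↑ʳ zero    j = refl
part-↑ʳ (suc t) j = part-↑ʳ t j

part-self : ∀ {n} (p : Fin n) → part (suc (toℕ p)) p ≡ true
part-self zero    = refl
part-self (suc p) = part-self p

part-punchIn : ∀ {n} (p : Fin (suc n)) i → part (suc (toℕ p)) (punchIn p i) ≡ part (toℕ p) i
part-punchIn zero    i       = refl
part-punchIn (suc p) zero    = refl
part-punchIn (suc p) (suc i) = part-punchIn p i

first-part-inhabited : ∀ {t s} → 1 ≤ t → ∃ λ (a : Fin (t ℕ.+ s)) → part t a ≡ true
first-part-inhabited {suc t} _ = zero , refl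

second-part-inhabited : ∀ {t s} → 1 ≤ s → ∃ λ (b : Fin (t ℕ.+ s)) → part t b ≡ false
second-part-inhabited {t} {suc s} _ = t ↑ʳ zero , part-↑ʳ t zero

K-cross : ∀ t s {a b : Fin (t ℕ.+ s)} → part t a ≡ true → part t b ≡ false → adj (K t s) a b ≡ true
K-cross t s a∈A b∈B = cong₂ _xor_ a∈A b∈B

count-part : ∀ t s → count (part {t ℕ.+ s} t) ≡ t
count-part zero    s = count-false (part {s} 0) (λ _ → refl)
count-part (suc t) s = cong suc (count-part t s)

count-not-part : ∀ t s → count (not ∘ part {t ℕ.+ s} t) ≡ s
count-not-part zero    s = count-true (not ∘ part {s} 0) (λ _ → refl)
count-not-part (suc t) s = count-not-part t s

degree-K : ∀ t s (i : Fin (t ℕ.+ s)) → degree (K t s) i ≡ (if part t i then s else t)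
degree-K t s i with part t i
... | true  = count-not-part t s
... | false = count-part t s

addVertex-K₁₁≅C3 : ∀ {t s} → t ≡ 1 → s ≡ 1 → (α : Fin (t ℕ.+ s) → Bool) → (∀ a → α a ≡ true) →
                   addVertex (K t s) α ≅ C3
addVertex-K₁₁≅C3 refl refl α α-true = ↔-id _ , adj-eq
  where
  adj-eq : ∀ i j → adj C3 i j ≡ adj (addVertex (K 1 1) α) i j
  adj-eq zero             zero             = refl
  adj-eq zero             (suc zero)       = sym (α-true zero)
  adj-eq zero             (suc (suc zero)) = sym (α-true (suc zero))
  adj-eq (suc zero)       zero             = sym (α-true zero)
  adj-eq (suc (suc zero)) zero             = sym (α-true (suc zero))
  adj-eq (suc zero)       (suc zero)       = refl
  adj-eq (suc zero)       (suc (suc zero)) = refl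
  adj-eq (suc (suc zero)) (suc zero)       = refl
  adj-eq (suc (suc zero)) (suc (suc zero)) = refl

-- The new vertex becomes the last vertex t of the first part; punchIn at t shifts the second part.
addVertex-K≅K : ∀ {t s} → s ≡ suc t → (α : Fin (t ℕ.+ s) → Bool) → (∀ a → α a ≡ not (part t a)) →
                addVertex (K t s) α ≅ K (suc t) (suc t)
addVertex-K≅K {t} refl α α-second = θ , adj-eq
  where
  p : Fin (suc (t ℕ.+ suc t))
  p = Fin.fromℕ< (s≤s (ℕP.m≤m+n t (suc t)))
  θ : Fin (suc (t ℕ.+ suc t)) ↔ Fin (suc t ℕ.+ suc t)
  θ = Perm.insert zero p Perm.id
  part-θ-zero : part (suc t) (Inverse.to θ zero) ≡ true
  part-θ-zero = subst (λ u → part (suc u) p ≡ true) (toℕ-fromℕ< _) (part-self p)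
  part-θ-suc : ∀ a → part (suc t) (Inverse.to θ (suc a)) ≡ part t a
  part-θ-suc a = trans (cong (part (suc t)) (Perm.insert-punchIn zero p Perm.id a))
                       (subst (λ u → part (suc u) (punchIn p a) ≡ part u a) (toℕ-fromℕ< _) (part-punchIn p a))
  K′ = K (suc t) (suc t)
  adj-eq : ∀ i j → adj K′ (Inverse.to θ i) (Inverse.to θ j) ≡ adj (addVertex (K t (suc t)) α) i j
  adj-eq zero    zero    = irref K′ (Inverse.to θ zero)
  adj-eq zero    (suc b) = trans (cong₂ _xor_ part-θ-zero (part-θ-suc b)) (sym (α-second b))
  adj-eq (suc a) zero    = trans (Graph.sym K′ (Inverse.to θ (suc a)) (Inverse.to θ zero)) (adj-eq zero (suc a))
  adj-eq (suc a) (suc b) = cong₂ _xor_ (part-θ-suc a) (part-θ-suc b)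

-- Eigenvectors of regular graphs

eigen-sum : ∀ {n} (G : Graph n) μ {x} → InEigenspace G μ x → ∀ v → sum (λ w → A G v w * x w) ≡ μ * x v
eigen-sum {n} G μ {x} eigen v = trans (sym (Σℚ≡sum n (λ w → A G v w * x w))) (eigen v)

dirichletTerm : ∀ {n} → Graph n → (Fin n → ℚ) → Fin n → Fin n → ℚ
dirichletTerm G x v w = A G v w * ((x v - x w) * (x v - x w))

dirichletTerm-nonneg : ∀ {n} (G : Graph n) x v w → 0ℚ ℚ.≤ dirichletTerm G x v w
dirichletTerm-nonneg G x v w with adj G v w
... | true  = ℚP.≤-trans (square-nonneg (x v - x w)) (ℚP.≤-reflexive (sym (ℚP.*-identityˡ _)))
... | false = ℚP.≤-reflexive (sym (ℚP.*-zeroˡ ((x v - x w) * (x v - x w))))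

dirichletEnergy : ∀ {n} → Graph n → (Fin n → ℚ) → ℚ
dirichletEnergy G x = sum₂ (dirichletTerm G x)

-- Expanding the squares, the energy is D + D′ − 2C with D = D′ = Σ_v deg v · x v² and C = xᵀ A x;
-- regularity and A x = r x make D = C.
dirichletEnergy-eigen≡0 : ∀ {n r} (G : Graph n) → Regular G r → ∀ {x} → InEigenspace G (ℕtoℚ r) x →
                          dirichletEnergy G x ≡ 0ℚ
dirichletEnergy-eigen≡0 {n} {r} G regular {x} eigen = ℚGroup.identityˡ-unique E (C + C) (begin
  E + (C + C)                                 ≡⟨ cong (E +_) (sum₂-distrib mixed mixed) ⟨
  E + sum₂ mixed₂                             ≡⟨ sum₂-distrib (dirichletTerm G x) mixed₂ ⟨
  sum₂ (λ v w → dirichletTerm G x v w + mixed₂ v w)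
                                              ≡⟨ sum₂-cong (λ v w → expand (A G v w) (x v) (x w)) ⟩
  sum₂ (λ v w → square v w + square′ v w)     ≡⟨ sum₂-distrib square square′ ⟩
  D + D′                                      ≡⟨ cong (D +_) D′≡D ⟩
  D + D                                       ≡⟨ cong₂ _+_ D≡C D≡C ⟩
  C + C                                       ∎)
  where
  open ≡.≡-Reasoning
  open +-*-Solver
  mixed mixed₂ square square′ : Fin n → Fin n → ℚ
  mixed v w = A G v w * (x v * x w)
  mixed₂ v w = mixed v w + mixed v w
  square v w = A G v w * (x v * x v)
  square′ v w = A G v w * (x w * x w)
  E = dirichletEnergy G x
  C = sum₂ mixed
  D = sum₂ square
  D′ = sum₂ square′

  expand : ∀ a p q → a * ((p - q) * (p - q)) + (a * (p * q) + a * (p * q)) ≡ a * (p * p) + a * (q * q)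
  expand = solve 3 (λ a p q → a :* ((p :- q) :* (p :- q)) :+ (a :* (p :* q) :+ a :* (p :* q))
                              := a :* (p :* p) :+ a :* (q :* q)) refl

  D′≡D : D′ ≡ D
  D′≡D = trans (sum₂-cong (λ v w → cong (_* (x w * x w)) (A-sym G v w))) (ℚΣ.∑-comm (λ v w → square w v))

  row : ∀ v → sum (square v) ≡ sum (mixed v)
  row v = begin
    sum (square v)                     ≡⟨ ℚΣ.*-distribʳ-sum (x v * x v) (A G v) ⟨
    sum (A G v) * (x v * x v)          ≡⟨ cong (_* (x v * x v)) (trans (sum-A G v) (cong ℕtoℚ (regular v))) ⟩
    d * (x v * x v)                    ≡⟨ solve 2 (λ d p → d :* (p :* p) := p :* (d :* p)) refl d (x v) ⟩
    x v * (d * x v)                    ≡⟨ cong (x v *_) (eigen-sum G d eigen v) ⟨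
    x v * sum (λ w → A G v w * x w)    ≡⟨ ℚΣ.*-distribˡ-sum (x v) (λ w → A G v w * x w) ⟩
    sum (λ w → x v * (A G v w * x w))  ≡⟨ ℚΣ.sum-cong-≗ (λ w → swap (x v) (A G v w) (x w)) ⟩
    sum (mixed v)                      ∎
    where
    d = ℕtoℚ r
    swap : ∀ p a q → p * (a * q) ≡ a * (p * q)
    swap = solve 3 (λ p a q → p :* (a :* q) := a :* (p :* q)) refl

  D≡C : D ≡ C
  D≡C = ℚΣ.sum-cong-≗ row

eigen-constant-on-edges : ∀ {n r} (G : Graph n) → Regular G r → ∀ {x} → InEigenspace G (ℕtoℚ r) x →
                          ∀ {v w} → adj G v w ≡ true → x v ≡ x w
eigen-constant-on-edges G regular {x} eigen {v} {w} v~w =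
  trans (ℚGroup.inverseˡ-unique _ _ (square≡0⇒≡0 _ square≡0)) (ℚGroup.⁻¹-involutive (x w))
  where
  term≥0 = dirichletTerm-nonneg G x
  row≡0 : sum (dirichletTerm G x v) ≡ 0ℚ
  row≡0 = sum-nonneg≡0⇒≡0 (λ v → sum (dirichletTerm G x v)) (λ v → sum-nonneg _ (term≥0 v))
            (dirichletEnergy-eigen≡0 G regular eigen) v
  square≡0 : (x v - x w) * (x v - x w) ≡ 0ℚ
  square≡0 = begin
    (x v - x w) * (x v - x w)         ≡⟨ ℚP.*-identityˡ _ ⟨
    1ℚ * ((x v - x w) * (x v - x w))  ≡⟨ cong (λ b → (if b then 1ℚ else 0ℚ) * ((x v - x w) * (x v - x w))) v~w ⟨
    dirichletTerm G x v w             ≡⟨ sum-nonneg≡0⇒≡0 (dirichletTerm G x v) (term≥0 v) row≡0 w ⟩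
    0ℚ                                ∎
    where open ≡.≡-Reasoning

module _ {n r t s} (G : Graph n) (regular : Regular G r)
         (ι : Fin (t ℕ.+ s) → Fin n) (ι-adj : ∀ a b → adj G (ι a) (ι b) ≡ adj (K t s) a b)
         {a₀ b₀ : Fin (t ℕ.+ s)} (a₀∈A : part t a₀ ≡ true) (b₀∈B : part t b₀ ≡ false) where

  eigen-constant-on-K : ∀ {x} → InEigenspace G (ℕtoℚ r) x → ∀ a → x (ι a) ≡ x (ι b₀)
  eigen-constant-on-K {x} eigen a = by-part (part t a) refl
    where
    constant : ∀ {v w} → adj G v w ≡ true → x v ≡ x w
    constant = eigen-constant-on-edges G regular eigen
    by-part : ∀ b → part t a ≡ b → x (ι a) ≡ x (ι b₀)
    by-part true  a∈A = constant (trans (ι-adj a b₀) (K-cross t s a∈A b₀∈B))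
    by-part false a∈B = trans (constant (trans (ι-adj a a₀) (trans (Graph.sym (K t s) a a₀) (K-cross t s a₀∈A a∈B))))
                              (constant (trans (ι-adj a₀ b₀) (K-cross t s a₀∈A b₀∈B)))

-- Linear dependence

combination : ∀ {k n} → (Fin k → ℚ) → (Fin k → Fin n → ℚ) → Fin n → ℚ
combination c vs j = sum λ i → c i * vs i j

DependentOn : ∀ {k n} → Subset n → (Fin k → Fin n → ℚ) → Set
DependentOn S vs = ∃ λ c → (∃ λ i → c i ≢ 0ℚ) × (∀ j → j ∈ S → combination c vs j ≡ 0ℚ)

dependentOn-∷ : ∀ {k n} b {S : Subset n} (vs : Fin k → Fin (suc n) → ℚ) →
                (zero ∈ b ∷ S → ∀ i → vs i zero ≡ 0ℚ) →
                DependentOn S (λ i j → vs i (suc j)) → DependentOn (b ∷ S) vs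
dependentOn-∷ b vs column₀ (c , nontrivial , vanish) = c , nontrivial , λ where
  zero    0∈        → sum-zero _ (λ i → trans (cong (c i *_) (column₀ 0∈ i)) (ℚP.*-zeroʳ (c i)))
  (suc j) (there j∈) → vanish j j∈

reduce : ∀ {k n} → (Fin (suc k) → Fin n → ℚ) → Fin (suc k) → (Fin k → ℚ) → Fin k → Fin n → ℚ
reduce vs p μ i j = vs (punchIn p i) j - μ i * vs p j

combination-insertAt : ∀ {k n} (c μ : Fin k → ℚ) (vs : Fin (suc k) → Fin n → ℚ) p j →
  combination (insertAt c p (sum λ i → - (c i * μ i))) vs j ≡ combination c (reduce vs p μ) j
combination-insertAt c μ vs p j = begin
  combination c⁺ vs j
    ≡⟨ ℚΣ.sum-remove {i = p} (λ i → c⁺ i * vs i j) ⟩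
  c⁺ p * vs p j + sum (λ i → c⁺ (punchIn p i) * vs (punchIn p i) j)
    ≡⟨ cong₂ (λ a b → a * vs p j + b) (insertAt-lookup c p cₚ)
             (ℚΣ.sum-cong-≗ (λ i → cong (_* vs (punchIn p i) j) (insertAt-punchIn c p cₚ i))) ⟩
  cₚ * vs p j + sum (λ i → c i * vs (punchIn p i) j)
    ≡⟨ cong (_+ sum (λ i → c i * vs (punchIn p i) j)) (ℚΣ.*-distribʳ-sum (vs p j) (λ i → - (c i * μ i))) ⟩
  sum (λ i → - (c i * μ i) * vs p j) + sum (λ i → c i * vs (punchIn p i) j)
    ≡⟨ ℚΣ.∑-distrib-+ (λ i → - (c i * μ i) * vs p j) (λ i → c i * vs (punchIn p i) j) ⟨
  sum (λ i → - (c i * μ i) * vs p j + c i * vs (punchIn p i) j)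
    ≡⟨ ℚΣ.sum-cong-≗ (λ i → regroup (c i) (μ i) (vs p j) (vs (punchIn p i) j)) ⟩
  combination c (reduce vs p μ) j
    ∎
  where
  open ≡.≡-Reasoning
  open +-*-Solver
  cₚ = sum λ i → - (c i * μ i)
  c⁺ = insertAt c p cₚ
  regroup : ∀ c m a b → - (c * m) * a + c * b ≡ c * (b - m * a)
  regroup = solve 4 (λ c m a b → :- (c :* m) :* a :+ c :* b := c :* (b :- m :* a)) refl

dependentOn-pivot : ∀ {k n} {S : Subset n} (vs : Fin (suc k) → Fin (suc n) → ℚ) p → vs p zero ≢ 0ℚ →
                    (∀ (ws : Fin k → Fin n → ℚ) → DependentOn S ws) → DependentOn (inside ∷ S) vs
dependentOn-pivot {k} {n} {S} vs p pivot≢0 dependent =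
  transfer (dependentOn-∷ inside (reduce vs p μ) (λ _ → column₀) (dependent λ i j → reduce vs p μ i (suc j)))
  where
  instance _ = ℚ.≢-nonZero pivot≢0
  μ : Fin k → ℚ
  μ i = vs (punchIn p i) zero * 1/ vs p zero
  column₀ : ∀ i → reduce vs p μ i zero ≡ 0ℚ
  column₀ i = begin
    b - b * 1/ a * a    ≡⟨ cong (λ z → b - z) (ℚP.*-assoc b (1/ a) a) ⟩
    b - b * (1/ a * a)  ≡⟨ cong (λ z → b - b * z) (ℚP.*-inverseˡ a) ⟩
    b - b * 1ℚ          ≡⟨ cong (λ z → b - z) (ℚP.*-identityʳ b) ⟩
    b - b               ≡⟨ ℚP.+-inverseʳ b ⟩
    0ℚ                  ∎
    where
    open ≡.≡-Reasoning
    a = vs p zero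
    b = vs (punchIn p i) zero
  transfer : DependentOn (inside ∷ S) (reduce vs p μ) → DependentOn (inside ∷ S) vs
  transfer (c , (i , cᵢ≢0) , vanish) =
    insertAt c p cₚ , (punchIn p i , cᵢ≢0 ∘ trans (sym (insertAt-punchIn c p cₚ i))) ,
    λ j j∈ → trans (combination-insertAt c μ vs p j) (vanish j j∈)
    where cₚ = sum λ i → - (c i * μ i)

∣S∣<k⇒dependentOn : ∀ {k n} (S : Subset n) (vs : Fin k → Fin n → ℚ) → ∣ S ∣ < k → DependentOn S vs
∣S∣<k⇒dependentOn {suc k} [] vs _ = (λ _ → 1ℚ) , (zero , ℚP.1≢0) , λ _ ()
∣S∣<k⇒dependentOn (outside ∷ S) vs ∣S∣<k =
  dependentOn-∷ outside vs (λ ()) (∣S∣<k⇒dependentOn S (λ i j → vs i (suc j)) ∣S∣<k)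
∣S∣<k⇒dependentOn {suc k} (inside ∷ S) vs (s≤s ∣S∣<k) with all? (λ i → vs i zero ℚ.≟ 0ℚ)
... | yes column₀ = dependentOn-∷ inside vs (λ _ → column₀)
                      (∣S∣<k⇒dependentOn S (λ i j → vs i (suc j)) (ℕP.m<n⇒m<1+n ∣S∣<k))
... | no ¬column₀ with ¬∀⟶∃¬ (suc k) _ (λ i → vs i zero ℚ.≟ 0ℚ) ¬column₀
...   | p , pivot≢0 = dependentOn-pivot vs p pivot≢0 (λ ws → ∣S∣<k⇒dependentOn S ws ∣S∣<k)

combination-eigen : ∀ {k n} (G : Graph n) μ (vs : Fin k → Fin n → ℚ) → (∀ i → InEigenspace G μ (vs i)) →
                    ∀ c → InEigenspace G μ (combination c vs)
combination-eigen {k} {n} G μ vs eigen c v = begin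
  Σℚ n (λ j → A G v j * combination c vs j)
    ≡⟨ Σℚ≡sum n _ ⟩
  sum (λ j → A G v j * sum (λ i → c i * vs i j))
    ≡⟨ ℚΣ.sum-cong-≗ (λ j → ℚΣ.*-distribˡ-sum (A G v j) (λ i → c i * vs i j)) ⟩
  sum (λ j → sum (λ i → A G v j * (c i * vs i j)))
    ≡⟨ ℚΣ.∑-comm (λ j i → A G v j * (c i * vs i j)) ⟩
  sum (λ i → sum (λ j → A G v j * (c i * vs i j)))
    ≡⟨ ℚΣ.sum-cong-≗ (λ i → trans (ℚΣ.sum-cong-≗ (λ j → swap (A G v j) (c i) (vs i j)))
                                   (sym (ℚΣ.*-distribˡ-sum (c i) (λ j → A G v j * vs i j)))) ⟩
  sum (λ i → c i * sum (λ j → A G v j * vs i j))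
    ≡⟨ ℚΣ.sum-cong-≗ (λ i → trans (cong (c i *_) (eigen-sum G μ (eigen i) v)) (swap (c i) μ (vs i v))) ⟩
  sum (λ i → μ * (c i * vs i v))
    ≡⟨ ℚΣ.*-distribˡ-sum μ (λ i → c i * vs i v) ⟨
  μ * combination c vs v
    ∎
  where
  open ≡.≡-Reasoning
  open +-*-Solver
  swap : ∀ a b x → a * (b * x) ≡ b * (a * x)
  swap = solve 3 (λ a b x → a :* (b :* x) := b :* (a :* x)) refl

induced-eigen : ∀ {m n} (G : Graph n) μ (e : Fin m → Fin n) → Injective _≡_ _≡_ e →
                ∀ {z} → InEigenspace G μ z → (∀ v → (∀ i → e i ≢ v) → z v ≡ 0ℚ) →
                InEigenspace (induced G e) μ (z ∘ e)
induced-eigen {m} G μ e e-inj {z} eigen z-off-image i = begin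
  Σℚ m (λ j → A G (e i) (e j) * z (e j))  ≡⟨ Σℚ≡sum m _ ⟩
  sum (λ j → A G (e i) (e j) * z (e j))   ≡⟨ sum-image e e-inj (λ v → A G (e i) v * z v) off-image ⟨
  sum (λ v → A G (e i) v * z v)           ≡⟨ eigen-sum G μ eigen (e i) ⟩
  μ * z (e i)                             ∎
  where
  open ≡.≡-Reasoning
  off-image : ∀ v → (∀ j → e j ≢ v) → A G (e i) v * z v ≡ 0ℚ
  off-image v v∉ = trans (cong (A G (e i) v *_) (z-off-image v v∉)) (ℚP.*-zeroʳ (A G (e i) v))

-- Star sets

nonempty-of-size : ∀ {n} (p : Subset n) → 1 ≤ ∣ p ∣ → Nonempty p
nonempty-of-size {n} p 1≤∣p∣ with nonempty? p
... | yes nonempty = nonempty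
... | no  empty    = ⊥-elim (ℕP.n≮0 (subst (1 ≤_) (trans (cong ∣_∣ (Empty-unique empty)) (∣⊥∣≡0 n)) 1≤∣p∣))

module StarSet {n m} {G : Graph n} {μ} {H : Graph m} (star : HasStarComplement G μ H) where
  open HasStarComplement star

  off-image⇒∈X : ∀ v → (∀ i → e i ≢ v) → v ∈ X
  off-image⇒∈X v v∉ with v ∈? X
  ... | yes v∈X = v∈X
  ... | no  v∉X with proj₁ (e-image v) v∉X
  ...   | i , eᵢ≡v = ⊥-elim (v∉ i eᵢ≡v)

  vanishing-on-X⇒zero : ∀ {z} → InEigenspace G μ z → (∀ v → v ∈ X → z v ≡ 0ℚ) → ∀ v → z v ≡ 0ℚ
  vanishing-on-X⇒zero {z} eigen z-on-X v with all? (λ i → z (e i) ℚ.≟ 0ℚ)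
  ... | no  ¬zero = ⊥-elim (notEig (z ∘ e , restricted , ¬∀⟶∃¬ m _ (λ i → z (e i) ℚ.≟ 0ℚ) ¬zero))
    where restricted = induced-eigen G μ e e-inj eigen (λ v → z-on-X v ∘ off-image⇒∈X v)
  ... | yes zero-on-image with v ∈? X
  ...   | yes v∈X = z-on-X v v∈X
  ...   | no  v∉X with proj₁ (e-image v) v∉X
  ...     | i , refl = zero-on-image i

  -- The k independent eigenvectors have a nontrivial combination vanishing on the k − 1 vertices
  -- X ∖ q, hence on all of X, hence everywhere.
  star-vertices-separated : ∀ {p q} → p ∈ X → q ∈ X → p ≢ q → ¬ (∀ z → InEigenspace G μ z → z p ≡ z q)
  star-vertices-separated {p} {q} p∈X q∈X p≢q linked =
    absurd (∣S∣<k⇒dependentOn (X ∖ q) basis (subst (∣ X ∖ q ∣ <_) size (x∈p⇒∣p-x∣<∣p∣ q∈X)))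
    where
    basis = proj₁ (proj₁ mult)
    basis-eigen = proj₁ (proj₂ (proj₁ mult))
    basis-independent = proj₂ (proj₂ (proj₁ mult))
    absurd : DependentOn (X ∖ q) basis → ⊥
    absurd (c , (i , cᵢ≢0) , vanish) = cᵢ≢0 (basis-independent c (λ j → trans (Σℚ≡sum k _) (z≡0 j)) i)
      where
      z = combination c basis
      z-eigen = combination-eigen G μ basis basis-eigen c
      z-on-X : ∀ j → j ∈ X → z j ≡ 0ℚ
      z-on-X j j∈X with j Fin.≟ q
      ... | yes refl = trans (sym (linked z z-eigen)) (vanish p (x∈p∧x≢y⇒x∈p-y p∈X p≢q))
      ... | no  j≢q  = vanish j (x∈p∧x≢y⇒x∈p-y j∈X j≢q)
      z≡0 = vanishing-on-X⇒zero z-eigen z-on-X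

module StarComplementK {n r t s} (G : Graph n) (regular : Regular G r) (1≤t : 1 ≤ t) (1≤s : 1 ≤ s)
                       (star : HasStarComplement G (ℕtoℚ r) (K t s)) where
  open HasStarComplement star
  open StarSet star

  f = proj₁ iso

  ι : Fin (t ℕ.+ s) → Fin n
  ι = e ∘ Inverse.from f

  ι-adj : ∀ a b → adj G (ι a) (ι b) ≡ adj (K t s) a b
  ι-adj a b = trans (sym (proj₂ iso _ _)) (cong₂ (adj (K t s)) (Inverse.strictlyInverseˡ f a) (Inverse.strictlyInverseˡ f b))

  a₀ b₀ : Fin (t ℕ.+ s)
  a₀ = proj₁ (first-part-inhabited {t} {s} 1≤t)
  b₀ = proj₁ (second-part-inhabited {t} {s} 1≤s)

  a₀∈A : part t a₀ ≡ true
  a₀∈A = proj₂ (first-part-inhabited {t} {s} 1≤t)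

  b₀∈B : part t b₀ ≡ false
  b₀∈B = proj₂ (second-part-inhabited {t} {s} 1≤s)

  has-neighbour : ∀ v → ∃ λ w → adj G v w ≡ true
  has-neighbour v = count-pos⇒witness (adj G v) (subst (1 ≤_) (trans (regular (ι a₀)) (sym (regular v))) a₀-degree)
    where a₀-degree = witness⇒count-pos (adj G (ι a₀)) (trans (ι-adj a₀ b₀) (K-cross t s a₀∈A b₀∈B))

  star-vertex-linked : ∀ {u} → u ∈ X → ∀ {z} → InEigenspace G (ℕtoℚ r) z → z u ≡ z (ι b₀)
  star-vertex-linked {u} u∈X {z} eigen with has-neighbour u
  ... | w , u~w with w ∈? X
  ...   | yes w∈X = ⊥-elim (star-vertices-separated u∈X w∈X (adjacent⇒≢ G u~w)
                              (λ z eigen → eigen-constant-on-edges G regular eigen u~w))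
  ...   | no  w∉X with proj₁ (e-image w) w∉X
  ...     | i , refl = begin
    z u                     ≡⟨ eigen-constant-on-edges G regular eigen u~w ⟩
    z (e i)                 ≡⟨ cong (z ∘ e) (Inverse.strictlyInverseʳ f i) ⟨
    z (ι (Inverse.to f i))  ≡⟨ eigen-constant-on-K {t = t} {s} G regular ι ι-adj a₀∈A b₀∈B eigen (Inverse.to f i) ⟩
    z (ι b₀)                ∎
    where open ≡.≡-Reasoning

  X-subsingleton : ∀ {u u′} → u ∈ X → u′ ∈ X → u ≡ u′
  X-subsingleton {u} {u′} u∈X u′∈X = decidable-stable (u Fin.≟ u′) λ u≢u′ →
    star-vertices-separated u∈X u′∈X u≢u′
      (λ z eigen → trans (star-vertex-linked u∈X eigen) (sym (star-vertex-linked u′∈X eigen)))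

  x : Fin n
  x = proj₁ (nonempty-of-size X (subst (1 ≤_) (sym size) k≥1))

  x∈X : x ∈ X
  x∈X = proj₂ (nonempty-of-size X (subst (1 ≤_) (sym size) k≥1))

  α : Fin (t ℕ.+ s) → Bool
  α a = adj G x (ι a)

  φ : Fin (suc (t ℕ.+ s)) → Fin n
  φ zero    = x
  φ (suc a) = ι a

  φ⁻¹ : Fin n → Fin (suc (t ℕ.+ s))
  φ⁻¹ v with v ∈? X
  ... | yes _   = zero
  ... | no  v∉X = suc (Inverse.to f (proj₁ (proj₁ (e-image v) v∉X)))

  φ-φ⁻¹ : ∀ v → φ (φ⁻¹ v) ≡ v
  φ-φ⁻¹ v with v ∈? X
  ... | yes v∈X = X-subsingleton x∈X v∈X
  ... | no  v∉X with proj₁ (e-image v) v∉X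
  ...   | i , eᵢ≡v = trans (cong e (Inverse.strictlyInverseʳ f i)) eᵢ≡v

  φ⁻¹-φ : ∀ a → φ⁻¹ (φ a) ≡ a
  φ⁻¹-φ zero with x ∈? X
  ... | yes _   = refl
  ... | no  x∉X = ⊥-elim (x∉X x∈X)
  φ⁻¹-φ (suc a) with ι a ∈? X
  ... | yes ιa∈X = ⊥-elim (proj₂ (e-image (ι a)) (Inverse.from f a , refl) ιa∈X)
  ... | no  ιa∉X with proj₁ (e-image (ι a)) ιa∉X
  ...   | i , eᵢ≡ιa = cong suc (trans (cong (Inverse.to f) (e-inj eᵢ≡ιa)) (Inverse.strictlyInverseˡ f a))

  φ-adj : ∀ a b → adj G (φ a) (φ b) ≡ adj (addVertex (K t s) α) a b
  φ-adj zero    zero    = irref G x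
  φ-adj zero    (suc b) = refl
  φ-adj (suc a) zero    = Graph.sym G (ι a) x
  φ-adj (suc a) (suc b) = ι-adj a b

  addVertex≅G : addVertex (K t s) α ≅ G
  addVertex≅G = mk↔ₛ′ φ φ⁻¹ φ-φ⁻¹ φ⁻¹-φ , φ-adj

  G≅addVertex : G ≅ addVertex (K t s) α
  G≅addVertex = ≅-sym {G = addVertex (K t s) α} {G} addVertex≅G

  addVertex-regular : Regular (addVertex (K t s) α) r
  addVertex-regular = regular-≅ {G = addVertex (K t s) α} {G} addVertex≅G regular

-- Regular one-vertex extensions of K t s

-- By definition, degree (addVertex H α) zero is count α and degree (addVertex H α) (suc a) is
-- ind (α a) + degree H a.
module _ {t s r} (1≤t : 1 ≤ t) (t≤s : t ≤ s) (α : Fin (t ℕ.+ s) → Bool)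
         (regular : Regular (addVertex (K t s) α) r) where

  private
    1≤s = ℕP.≤-trans 1≤t t≤s
    a₀ b₀ : Fin (t ℕ.+ s)
    a₀ = proj₁ (first-part-inhabited {t} {s} 1≤t)
    b₀ = proj₁ (second-part-inhabited {t} {s} 1≤s)
    a₀∈A : part t a₀ ≡ true
    a₀∈A = proj₂ (first-part-inhabited {t} {s} 1≤t)
    b₀∈B : part t b₀ ≡ false
    b₀∈B = proj₂ (second-part-inhabited {t} {s} 1≤s)

  degree-suc : ∀ a → ind (α a) ℕ.+ (if part t a then s else t) ≡ r
  degree-suc a = trans (cong (ind (α a) ℕ.+_) (sym (degree-K t s a))) (regular (suc a))

  same-part⇒same-α : ∀ {a b} → part t a ≡ part t b → α a ≡ α b
  same-part⇒same-α {a} {b} same = ind-injective (ℕP.+-cancelʳ-≡ _ _ _ (trans (degree-suc a)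
    (sym (subst (λ p → ind (α b) ℕ.+ (if p then s else t) ≡ r) (sym same) (degree-suc b)))))

  α-by-part : ∀ a → α a ≡ (if part t a then α a₀ else α b₀)
  α-by-part a with part t a in a-part
  ... | true  = same-part⇒same-α (trans a-part (sym a₀∈A))
  ... | false = same-part⇒same-α (trans a-part (sym b₀∈B))

  α-constant : ∀ {c} → α a₀ ≡ c → α b₀ ≡ c → ∀ a → α a ≡ c
  α-constant αa₀ αb₀ a with part t a | α-by-part a
  ... | true  | αa = trans αa αa₀
  ... | false | αa = trans αa αb₀

  degree-a₀ : ∀ {c} → α a₀ ≡ c → ind c ℕ.+ s ≡ r
  degree-a₀ αa₀ = subst (λ c → ind c ℕ.+ s ≡ r) αa₀
    (subst (λ p → ind (α a₀) ℕ.+ (if p then s else t) ≡ r) a₀∈A (degree-suc a₀))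

  degree-b₀ : ∀ {c} → α b₀ ≡ c → ind c ℕ.+ t ≡ r
  degree-b₀ αb₀ = subst (λ c → ind c ℕ.+ t ≡ r) αb₀
    (subst (λ p → ind (α b₀) ℕ.+ (if p then s else t) ≡ r) b₀∈B (degree-suc b₀))

  addVertex-K-classification :
    (s ≡ 1 × t ≡ 1 × addVertex (K t s) α ≅ C3) ⊎ (r ≡ s × s ≡ suc t × addVertex (K t s) α ≅ K (suc t) (suc t))
  addVertex-K-classification with α a₀ in αa₀ | α b₀ in αb₀
  ... | false | false = ⊥-elim (ℕP.n≮0 (subst (1 ≤_) s≡0 1≤s))
    where
    s≡0 : s ≡ 0
    s≡0 = trans (degree-a₀ αa₀) (trans (sym (regular zero)) (count-false α (α-constant αa₀ αb₀)))
  ... | true  | false = ⊥-elim (ℕP.<-irrefl refl (subst (_≤ s) (trans (degree-b₀ αb₀) (sym (degree-a₀ αa₀))) t≤s))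
  ... | true  | true  = inj₁ (s≡1 , t≡1 , addVertex-K₁₁≅C3 t≡1 s≡1 α (α-constant αa₀ αb₀))
    where
    t+s≡1+s : t ℕ.+ s ≡ 1 ℕ.+ s
    t+s≡1+s = begin
      t ℕ.+ s  ≡⟨ count-true α (α-constant αa₀ αb₀) ⟨
      count α  ≡⟨ regular zero ⟩
      r        ≡⟨ degree-a₀ αa₀ ⟨
      1 ℕ.+ s  ∎
      where open ≡.≡-Reasoning
    t≡1 : t ≡ 1
    t≡1 = ℕP.+-cancelʳ-≡ s t 1 t+s≡1+s
    s≡1 : s ≡ 1
    s≡1 = trans (ℕP.suc-injective (trans (degree-a₀ αa₀) (sym (degree-b₀ αb₀)))) t≡1
  ... | false | true  = inj₂ (sym (degree-a₀ αa₀) , s≡1+t , addVertex-K≅K s≡1+t α α-complement)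
    where
    s≡1+t : s ≡ suc t
    s≡1+t = trans (degree-a₀ αa₀) (sym (degree-b₀ αb₀))
    α-complement : ∀ a → α a ≡ not (part t a)
    α-complement a with part t a | α-by-part a
    ... | true  | αa = trans αa αa₀
    ... | false | αa = trans αa αb₀

theorem3p4 : (s t r n : ℕ) → 1 ≤ t → t ≤ s → (G : Graph n) → Regular G r
    → HasStarComplement G (ℕtoℚ r) (K t s)
    → (s ≡ 1 × t ≡ 1 × G ≅ C3) ⊎ (r ≡ s × s ≡ suc t × G ≅ K (suc t) (suc t))
theorem3p4 s t r n 1≤t t≤s G regular star =
  Sum.map (map₂ (map₂ (via C3))) (map₂ (map₂ (via (K (suc t) (suc t)))))
          (addVertex-K-classification 1≤t t≤s α addVertex-regular)
  where
  open StarComplementK G regular 1≤t (ℕP.≤-trans 1≤t t≤s) star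
  via : ∀ {m} (H : Graph m) → addVertex (K t s) α ≅ H → G ≅ H
  via H = ≅-trans {G = G} {addVertex (K t s) α} {H} G≅addVertex
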